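{- Let $G_1,\dots,G_n$ be simple graphs and $A$ an abelian group. If $0\in spec(G_k,A)$ for some $k\in\{1,\dots,n\}$, then $0\in spec(G_1\otimes G_2\otimes\cdots\otimes G_n,A)$.
   Context: The tensor product $G\otimes H$ has vertex set $V(G)\times V(H)$, with $(g,h)$ adjacent to $(g',h')$ iff $gg'\in E(G)$ and $hh'\in E(H)$; iterated. For an additive abelian group $A$ with identity $0$, an $A$-vertex magic labeling of $G$ is a map $l:V(G)\to A\setminus\{0\}$ with $\sum_{u\in N_G(v)} l(u)=\mu$ for all $v$, for some fixed $\mu\in A$ (the magic constant); $spec(G,A)$ is the set of all such magic constants. -}

module Defs where

open import Level using (Level)
open import Data.Nat using (ℕ; suc; _*_)
open import Data.Fin using (Fin; remQuot)
open import Data.Bool using (Bool; true; false; _∧_; if_then_else_)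
open import Data.Product using (_×_; _,_; proj₁; proj₂; Σ)
open import Data.Vec using (Vec; lookup; foldr₁)
open import Relation.Binary.PropositionalEquality using (_≡_)
open import Relation.Nullary using (¬_)
open import Algebra.Bundles using (AbelianGroup)
import Algebra.Definitions.RawMonoid as RM

record Graph : Set where
  field
    order   : ℕ
    adj     : Fin order → Fin order → Bool
    adj-sym : ∀ u v → adj u v ≡ adj v u
    irrefl  : ∀ v → adj v v ≡ false
open Graph public

-- Tensor (direct / categorical) product: vertex set Fin (m * n) ≅ Fin m × Fin n
-- via remQuot; (g,h) ~ (g',h') iff g ~ g' and h ~ h'.
_⊗_ : Graph → Graph → Graph
G ⊗ H = record
  { order   = order G * order H
  ; adj     = λ x y → adj G (proj₁ (p x)) (proj₁ (p y)) ∧ adj H (proj₂ (p x)) (proj₂ (p y))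
  ; adj-sym = λ x y → eq x y
  ; irrefl  = λ x → irr x
  }
  where
  p : Fin (order G * order H) → Fin (order G) × Fin (order H)
  p = remQuot (order H)
  open import Relation.Binary.PropositionalEquality using (cong₂; trans; refl)
  open import Data.Bool.Properties using (∧-zeroˡ)
  eq : ∀ x y → (adj G (proj₁ (p x)) (proj₁ (p y)) ∧ adj H (proj₂ (p x)) (proj₂ (p y)))
             ≡ (adj G (proj₁ (p y)) (proj₁ (p x)) ∧ adj H (proj₂ (p y)) (proj₂ (p x)))
  eq x y = cong₂ _∧_ (adj-sym G _ _) (adj-sym H _ _)
  irr : ∀ x → (adj G (proj₁ (p x)) (proj₁ (p x)) ∧ adj H (proj₂ (p x)) (proj₂ (p x))) ≡ false
  irr x = trans (cong₂ _∧_ (irrefl G _) refl) (∧-zeroˡ (adj H (proj₂ (p x)) (proj₂ (p x))))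

⨂ : ∀ {n} → Vec Graph (suc n) → Graph
⨂ = foldr₁ _⊗_

module _ {c ℓ : Level} (A : AbelianGroup c ℓ) where
  open AbelianGroup A

  neighbourSum : (G : Graph) → (Fin (order G) → Carrier) → Fin (order G) → Carrier
  neighbourSum G l v = RM.sum rawMonoid (λ u → if adj G v u then l u else ε)

  IsVertexMagic : (G : Graph) → (Fin (order G) → Carrier) → Carrier → Set ℓ
  IsVertexMagic G l μ = (∀ v → ¬ (l v ≈ ε)) × (∀ v → neighbourSum G l v ≈ μ)

  _∈spec_ : Carrier → Graph → Set (c Level.⊔ ℓ)
  μ ∈spec G = Σ (Fin (order G) → Carrier) λ l → IsVertexMagic G l μ

-- The neighbourhood of (g , h) in G ⊗ H is N(g) × N(h). Hence for a labelling l
-- of H, pulled back along the projection G ⊗ H → H, the neighbour sum at (g , h)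
-- is the neighbour sum of l at h, counted once for each neighbour of g; it is 0
-- whenever l is zero-magic, and likewise for the other factor. Induction along
-- G₁ ⊗ (G₂ ⊗ (⋯ ⊗ Gₙ)) carries the zero-magic labelling of Gₖ to the whole product.
{-# OPTIONS --safe #-}
module Submission where

open import Defs
open import Level using (Level)
open import Data.Nat using (ℕ; suc; zero; _+_; _*_)
open import Data.Fin using (Fin; _↑ˡ_; _↑ʳ_; remQuot; quotient; remainder; combine)
open import Data.Fin.Properties using (remQuot-combine)
open import Data.Vec using (Vec; lookup; _∷_; [])
open import Data.Bool using (Bool; true; false; _∧_; if_then_else_)
open import Data.Bool.Properties using (∧-comm)
open import Data.Product using (_×_; _,_; proj₁; proj₂)
open import Function using (_∘_)
open import Algebra.Bundles using (AbelianGroup)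
open import Relation.Binary.PropositionalEquality as ≡ using (_≡_)

module ZeroMagic {c ℓ : Level} (A : AbelianGroup c ℓ) where
  open AbelianGroup A
  open import Algebra.Properties.CommutativeMonoid.Sum commutativeMonoid
  open import Relation.Binary.Reasoning.Setoid setoid

  sum-↑ : ∀ m n (f : Fin (m + n) → Carrier) →
          sum f ≈ sum (f ∘ (_↑ˡ n)) ∙ sum (f ∘ (m ↑ʳ_))
  sum-↑ zero    n f = sym (identityˡ _)
  sum-↑ (suc m) n f = trans (∙-congˡ (sum-↑ m n (f ∘ Fin.suc))) (sym (assoc _ _ _))

  sum-combine : ∀ m n (f : Fin (m * n) → Carrier) →
                sum f ≈ ∑[ i < m ] ∑[ j < n ] f (combine i j)
  sum-combine zero    n f = refl
  sum-combine (suc m) n f =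
    trans (sum-↑ n (m * n) f) (∙-congˡ (sum-combine m n (f ∘ (n ↑ʳ_))))

  sum-remQuot : ∀ m n (f : Fin m × Fin n → Carrier) →
                sum (f ∘ remQuot {m} n) ≈ ∑[ i < m ] ∑[ j < n ] f (i , j)
  sum-remQuot m n f = begin
    sum (f ∘ remQuot {m} n)                             ≈⟨ sum-combine m n _ ⟩
    ∑[ i < m ] ∑[ j < n ] f (remQuot n (combine i j))  ≡⟨ sum-cong-≗ (λ i → sum-cong-≗ (λ j →
                                                           ≡.cong f (remQuot-combine i j))) ⟩
    ∑[ i < m ] ∑[ j < n ] f (i , j)                     ∎

  when : Bool → Carrier → Carrier
  when b x = if b then x else ε

  when-∧ : ∀ a b x → when (a ∧ b) x ≡ when a (when b x)
  when-∧ true  b x = ≡.refl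
  when-∧ false b x = ≡.refl

  when-ε : ∀ b {x} → x ≈ ε → when b x ≈ ε
  when-ε true  x≈ε = x≈ε
  when-ε false x≈ε = refl

  sum-when : ∀ {n} b (t : Fin n → Carrier) → sum (λ j → when b (t j)) ≈ when b (sum t)
  sum-when     true  t = refl
  sum-when {n} false t = sum-replicate-zero n

  sum-when-ε : ∀ {n} (bs : Fin n → Bool) {x} → x ≈ ε → sum (λ i → when (bs i) x) ≈ ε
  sum-when-ε {n} bs x≈ε = trans (sum-cong-≋ (λ i → when-ε (bs i) x≈ε)) (sum-replicate-zero n)

  module _ (G H : Graph) where
    private
      m = order G
      n = order H

    neighbourSum-⊗ : ∀ (L : Fin m × Fin n → Carrier) x →
      neighbourSum A (G ⊗ H) (L ∘ remQuot n) x
        ≈ ∑[ i < m ] ∑[ j < n ] when (adj G (quotient n x) i ∧ adj H (remainder {m} n x) j) (L (i , j))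
    neighbourSum-⊗ L x = sum-remQuot m n _

    neighbourSum-liftˡ : ∀ (l : Fin m → Carrier) x →
      neighbourSum A (G ⊗ H) (l ∘ quotient n) x
        ≈ ∑[ j < n ] when (adj H (remainder {m} n x) j) (neighbourSum A G l (quotient n x))
    neighbourSum-liftˡ l x = begin
      neighbourSum A (G ⊗ H) (l ∘ quotient n) x
        ≈⟨ neighbourSum-⊗ (l ∘ proj₁) x ⟩
      ∑[ i < m ] ∑[ j < n ] when (a i ∧ b j) (l i)
        ≈⟨ ∑-comm (λ i j → when (a i ∧ b j) (l i)) ⟩
      ∑[ j < n ] ∑[ i < m ] when (a i ∧ b j) (l i)
        ≡⟨ sum-cong-≗ (λ j → sum-cong-≗ (λ i →
             ≡.trans (≡.cong (λ t → when t (l i)) (∧-comm (a i) (b j))) (when-∧ (b j) (a i) (l i)))) ⟩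
      ∑[ j < n ] ∑[ i < m ] when (b j) (when (a i) (l i))
        ≈⟨ sum-cong-≋ (λ j → sum-when (b j) (λ i → when (a i) (l i))) ⟩
      ∑[ j < n ] when (b j) (neighbourSum A G l (quotient n x)) ∎
      where
      a = adj G (quotient n x)
      b = adj H (remainder {m} n x)

    neighbourSum-liftʳ : ∀ (l : Fin n → Carrier) x →
      neighbourSum A (G ⊗ H) (l ∘ remainder {m} n) x
        ≈ ∑[ i < m ] when (adj G (quotient n x) i) (neighbourSum A H l (remainder {m} n x))
    neighbourSum-liftʳ l x = begin
      neighbourSum A (G ⊗ H) (l ∘ remainder {m} n) x
        ≈⟨ neighbourSum-⊗ (l ∘ proj₂) x ⟩
      ∑[ i < m ] ∑[ j < n ] when (a i ∧ b j) (l j)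
        ≡⟨ sum-cong-≗ (λ i → sum-cong-≗ (λ j → when-∧ (a i) (b j) (l j))) ⟩
      ∑[ i < m ] ∑[ j < n ] when (a i) (when (b j) (l j))
        ≈⟨ sum-cong-≋ (λ i → sum-when (a i) (λ j → when (b j) (l j))) ⟩
      ∑[ i < m ] when (a i) (neighbourSum A H l (remainder {m} n x)) ∎
      where
      a = adj G (quotient n x)
      b = adj H (remainder {m} n x)

    ε∈spec-⊗ˡ : _∈spec_ A ε G → _∈spec_ A ε (G ⊗ H)
    ε∈spec-⊗ˡ (l , l≉ε , magic) =
      l ∘ quotient n , (λ x → l≉ε _) ,
      λ x → trans (neighbourSum-liftˡ l x) (sum-when-ε (adj H (remainder {m} n x)) (magic (quotient n x)))

    ε∈spec-⊗ʳ : _∈spec_ A ε H → _∈spec_ A ε (G ⊗ H)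
    ε∈spec-⊗ʳ (l , l≉ε , magic) =
      l ∘ remainder {m} n , (λ x → l≉ε _) ,
      λ x → trans (neighbourSum-liftʳ l x) (sum-when-ε (adj G (quotient n x)) (magic (remainder {m} n x)))

mainTheorem17 : {c ℓ : Level} (A : AbelianGroup c ℓ) (n : ℕ) (Gs : Vec Graph (suc n))
    → (k : Fin (suc n)) → _∈spec_ A (AbelianGroup.ε A) (lookup Gs k)
    → _∈spec_ A (AbelianGroup.ε A) (⨂ Gs)
mainTheorem17 A zero    (G ∷ [])      Fin.zero    ε∈spec = ε∈spec
mainTheorem17 A (suc n) (G ∷ H ∷ Gs) Fin.zero    ε∈spec = ZeroMagic.ε∈spec-⊗ˡ A G (⨂ (H ∷ Gs)) ε∈spec
mainTheorem17 A (suc n) (G ∷ H ∷ Gs) (Fin.suc k) ε∈spec =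
  ZeroMagic.ε∈spec-⊗ʳ A G (⨂ (H ∷ Gs)) (mainTheorem17 A n (H ∷ Gs) k ε∈spec)
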